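{- $R_{5}(VS) > 180$. That is, there is a $5$-coloring of $[180]$ in which no two distinct integers of the same color differ by $x^2$ for any positive integer $x$.
   Context: For $n\in\mathbb{N}$, $[n]=\{1,\dots,n\}$; a $c$-coloring of $[n]$ is a function $[n]\to[c]$. For a positive integer $c$, $R_c(VS)$ (the "van der Square" number) is the least positive integer $n$ such that every $c$-coloring of $[n]$ contains two integers $a<b$ in $[n]$ of the same color with $b-a=x^2$ for some positive integer $x$. -}

module Defs where

open import Data.Nat using (ℕ; suc; _+_; _*_; _<_)
open import Data.Fin using (Fin; toℕ)
open import Data.Product using (Σ; ∃; _×_)
open import Relation.Binary.PropositionalEquality using (_≡_)
open import Relation.Nullary using (¬_)

-- [n] = {1,…,n} is represented by Fin n, with i : Fin n standing for toℕ i + 1.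
-- Differences are unaffected by this shift.

Coloring : ℕ → ℕ → Set
Coloring c n = Fin n → Fin c

IsPosSquare : ℕ → Set
IsPosSquare d = Σ ℕ λ x → (0 < x) × (d ≡ x * x)

HasMonoSquarePair : ∀ {c n} → Coloring c n → Set
HasMonoSquarePair {c} {n} χ =
  Σ (Fin n) λ a → Σ (Fin n) λ b →
    (toℕ a < toℕ b) × (χ a ≡ χ b) × Σ ℕ λ x → (0 < x) × (toℕ b ≡ toℕ a + x * x)

-- n has the van der Square property for c colors: every c-coloring of [n]
-- contains such a pair.  R_c(VS) is the least such positive n.
VdSProperty : ℕ → ℕ → Set
VdSProperty c n = (χ : Coloring c n) → HasMonoSquarePair χ

-- A square-difference-free c-coloring of [n] witnesses R_c(VS) > n.
SquareFreeColoring : ℕ → ℕ → Set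
SquareFreeColoring c n = Σ (Coloring c n) λ χ → ¬ HasMonoSquarePair χ

{-# OPTIONS --safe #-}
module Submission where

-- A monochromatic pair
-- (a, a + x²) in [n] has x² < n, so when n ≤ s² it suffices to search over a and x < s:
-- for [180] that is 180 · 14 comparisons, decided by evaluation.

open import Defs
open import Data.Empty using (⊥-elim)
open import Data.Fin using (Fin; toℕ; fromℕ<; #_)
open import Data.Fin.Properties using (any?; toℕ<n; toℕ-fromℕ<; toℕ-injective) renaming (_≟_ to _≟ᶠ_)
open import Data.Nat using (ℕ; _+_; _*_; _<_; _≤_; _<?_; _≤?_; >-nonZero)
open import Data.Nat.Properties
  using (anyUpTo?; <-≤-trans; ≤-<-trans; m≤m*n; m≤n+m; m<m+n; *-mono-≤; ≮⇒≥; <⇒≱)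
open import Data.Product using (Σ; ∃; _×_; _,_)
open import Data.Vec using (Vec; _∷_; []; lookup)
open import Relation.Binary.PropositionalEquality using (_≡_; sym; trans; cong; subst)
open import Relation.Nullary using (Dec; yes; no; _×-dec_)
open import Relation.Nullary.Decidable using (map′; from-no; from-yes)

m*m<n*n⇒m<n : ∀ {m n} → m * m < n * n → m < n
m*m<n*n⇒m<n {m} {n} m²<n² with m <? n
... | yes m<n = m<n
... | no m≮n = let n≤m = ≮⇒≥ m≮n in ⊥-elim (<⇒≱ m²<n² (*-mono-≤ n≤m n≤m))

module _ {c n} (χ : Coloring c n) where

  MonoSquareStep : Fin n → ℕ → Set
  MonoSquareStep a x = (0 < x) × Σ (toℕ a + x * x < n) λ b<n → χ a ≡ χ (fromℕ< b<n)

  monoSquareStep? : ∀ a x → Dec (MonoSquareStep a x)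
  monoSquareStep? a x = 0 <? x ×-dec step?
    where
    step? : Dec (Σ (toℕ a + x * x < n) λ b<n → χ a ≡ χ (fromℕ< b<n))
    step? with toℕ a + x * x <? n
    ... | yes b<n = map′ (b<n ,_) (λ (_ , eq) → eq) (χ a ≟ᶠ χ (fromℕ< b<n))
    ... | no b≮n = no λ (b<n , _) → b≮n b<n

  monoSquarePair⇒step : ∀ s → n ≤ s * s →
                        HasMonoSquarePair χ → ∃ λ a → ∃ λ x → x < s × MonoSquareStep a x
  monoSquarePair⇒step s n≤s² (a , b , _ , eq , x , 0<x , b≡a+x²) =
    a , x , x<s , 0<x , b<n , trans eq (cong χ b≡fromℕ<)
    where
    b<n : toℕ a + x * x < n
    b<n = subst (_< n) b≡a+x² (toℕ<n b)
    x<s : x < s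
    x<s = m*m<n*n⇒m<n (<-≤-trans (≤-<-trans (m≤n+m (x * x) (toℕ a)) b<n) n≤s²)
    b≡fromℕ< : b ≡ fromℕ< b<n
    b≡fromℕ< = toℕ-injective (trans b≡a+x² (sym (toℕ-fromℕ< b<n)))

  step⇒monoSquarePair : ∀ a x → MonoSquareStep a x → HasMonoSquarePair χ
  step⇒monoSquarePair a x (0<x , b<n , eq) =
    a , fromℕ< b<n , a<b , eq , x , 0<x , toℕ-fromℕ< b<n
    where
    a<b : toℕ a < toℕ (fromℕ< b<n)
    a<b = subst (toℕ a <_) (sym (toℕ-fromℕ< b<n))
                (m<m+n (toℕ a) (<-≤-trans 0<x (m≤m*n x x ⦃ >-nonZero 0<x ⦄)))

  hasMonoSquarePair? : ∀ s → n ≤ s * s → Dec (HasMonoSquarePair χ)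
  hasMonoSquarePair? s n≤s² =
    map′ (λ (a , x , _ , step) → step⇒monoSquarePair a x step) (monoSquarePair⇒step s n≤s²)
      (any? λ a → anyUpTo? (monoSquareStep? a) s)

colors : Vec (Fin 5) 180
colors =
  # 3 ∷ # 2 ∷ # 3 ∷ # 0 ∷ # 2 ∷ # 0 ∷ # 2 ∷ # 1 ∷ # 3 ∷ # 1 ∷ # 0 ∷ # 4 ∷ # 2 ∷ # 3 ∷ # 2 ∷ # 1 ∷ # 0 ∷ # 4 ∷ # 0 ∷ # 2 ∷
  # 1 ∷ # 3 ∷ # 4 ∷ # 0 ∷ # 4 ∷ # 2 ∷ # 1 ∷ # 2 ∷ # 1 ∷ # 0 ∷ # 4 ∷ # 0 ∷ # 3 ∷ # 2 ∷ # 3 ∷ # 4 ∷ # 0 ∷ # 4 ∷ # 2 ∷ # 1 ∷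
  # 3 ∷ # 1 ∷ # 0 ∷ # 4 ∷ # 0 ∷ # 3 ∷ # 1 ∷ # 3 ∷ # 4 ∷ # 0 ∷ # 4 ∷ # 2 ∷ # 1 ∷ # 3 ∷ # 1 ∷ # 0 ∷ # 4 ∷ # 0 ∷ # 3 ∷ # 1 ∷
  # 3 ∷ # 4 ∷ # 0 ∷ # 4 ∷ # 2 ∷ # 1 ∷ # 2 ∷ # 1 ∷ # 0 ∷ # 4 ∷ # 0 ∷ # 3 ∷ # 1 ∷ # 3 ∷ # 4 ∷ # 0 ∷ # 4 ∷ # 2 ∷ # 1 ∷ # 3 ∷
  # 1 ∷ # 0 ∷ # 4 ∷ # 0 ∷ # 3 ∷ # 1 ∷ # 3 ∷ # 4 ∷ # 0 ∷ # 4 ∷ # 2 ∷ # 1 ∷ # 3 ∷ # 1 ∷ # 0 ∷ # 4 ∷ # 0 ∷ # 3 ∷ # 1 ∷ # 3 ∷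
  # 4 ∷ # 0 ∷ # 4 ∷ # 2 ∷ # 1 ∷ # 2 ∷ # 1 ∷ # 0 ∷ # 4 ∷ # 0 ∷ # 3 ∷ # 1 ∷ # 3 ∷ # 4 ∷ # 0 ∷ # 4 ∷ # 2 ∷ # 1 ∷ # 3 ∷ # 1 ∷
  # 0 ∷ # 4 ∷ # 0 ∷ # 2 ∷ # 1 ∷ # 3 ∷ # 4 ∷ # 0 ∷ # 4 ∷ # 2 ∷ # 3 ∷ # 2 ∷ # 1 ∷ # 0 ∷ # 2 ∷ # 0 ∷ # 2 ∷ # 1 ∷ # 3 ∷ # 4 ∷
  # 0 ∷ # 4 ∷ # 2 ∷ # 1 ∷ # 2 ∷ # 1 ∷ # 0 ∷ # 4 ∷ # 0 ∷ # 3 ∷ # 1 ∷ # 3 ∷ # 4 ∷ # 0 ∷ # 4 ∷ # 2 ∷ # 1 ∷ # 2 ∷ # 1 ∷ # 0 ∷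
  # 4 ∷ # 0 ∷ # 2 ∷ # 1 ∷ # 3 ∷ # 4 ∷ # 0 ∷ # 4 ∷ # 2 ∷ # 1 ∷ # 3 ∷ # 1 ∷ # 3 ∷ # 4 ∷ # 2 ∷ # 3 ∷ # 2 ∷ # 1 ∷ # 4 ∷ # 2 ∷ []

mainTheorem6 : SquareFreeColoring 5 180
mainTheorem6 = lookup colors , from-no (hasMonoSquarePair? (lookup colors) 14 (from-yes (180 ≤? 196)))
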